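{- Let $q\ge 2$, $1\le u<v\le q$, let $M=M^{[q]}_{u,v}$ and let $\omega_{u,v}\in\mathfrak S_{2q}$ be its Siegel Ekedahl–Oort permutation. Then $F$ acts nilpotently on $M$ if and only if $\omega_{u,v}(1)=1$.
   Context: Let $k=\overline{\mathbb F}_p$. $M^{[q]}_{u,v}$ is the $2q$-dimensional $k$-space with basis $e_{i,j}$, $i\in\{1,2\}$, $1\le j\le q$, and Frobenius-semilinear $F$, Frobenius$^{ -1}$-semilinear $V$ extending $F(e_{1,j})=0$ if $j\in\{u,v\}$; $=e_{2,j}$ if $j\le u-1$; $=e_{2,j-1}$ if $u<j\le v-1$; $=e_{2,j-2}$ if $j>v$. $V(e_{1,j})=0$ if $j\in\{1,2\}$; $=e_{2,j-2}$ if $2<j\le q-v+2$; $=e_{2,j-1}$ if $q-v+2<j\le q-u+1$; $=e_{2,j}$ if $j>q-u+1$. $F(e_{2,j})=e_{1,1}$ if $j=q-v+1$; $=e_{1,2}$ if $j=q-u+1$; $0$ otherwise. $V(e_{2,j})=e_{1,u}$ if $j=q-1$; $=e_{1,v}$ if $j=q$; $0$ otherwise. A final filtration is a full flag $0=W_0\subset\cdots\subset W_{2q}=M$, $\dim W_j=j$, such that $F(W_j)$ and $V^{ -1}(W_j)=\{x:Vx\in W_j\}$ are members of the flag. With $\eta(j)=\dim(W_j\cap\ker F)$, let $j_1<\cdots<j_q$ be the indices where $\eta$ increases ($\eta(j)=\eta(j-1)+1$) and $i_1<\cdots<i_q$ the remaining indices of $\{1,\dots,2q\}$; the Siegel Ekedahl–Oort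 permutation is $\omega_{u,v}(j_l)=l$, $\omega_{u,v}(i_m)=q+m$ (independent of the final filtration). -}

module Defs where

open import Level using (Level; _⊔_)
open import Data.Nat as ℕ using (ℕ; zero; suc; _≤_; _<_; _≡ᵇ_; _<ᵇ_; _∸_)
open import Data.Nat.Primality using (Prime)
open import Data.Fin using (Fin; toℕ) renaming (zero to fzero; suc to fsuc)
open import Data.Bool using (Bool; true; false; if_then_else_; _∧_; _∨_)
open import Data.Maybe using (Maybe; just; nothing)
open import Data.Product using (Σ; _×_; _,_; ∃)
open import Data.Sum using (_⊎_)
open import Relation.Nullary using (¬_)
open import Relation.Binary.PropositionalEquality using (_≡_)
open import Algebra.Bundles using (CommutativeRing)

-- The field k = algebraic closure of F_p, characterised (up to
-- isomorphism) as: a field of characteristic p (p prime) which is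
-- algebraically closed and every element of which lies in a finite
-- subfield, i.e. satisfies x^(p^n) = x for some n ≥ 1.

module RingUtil {c ℓ} (R : CommutativeRing c ℓ) where
  open CommutativeRing R

  pow : Carrier → ℕ → Carrier
  pow x zero = 1#
  pow x (suc n) = x * pow x n

  natK : ℕ → Carrier
  natK zero = 0#
  natK (suc n) = 1# + natK n

  sumFin : (n : ℕ) → (Fin n → Carrier) → Carrier
  sumFin zero f = 0#
  sumFin (suc n) f = f fzero + sumFin n (λ i → f (fsuc i))


  monicEval : (n : ℕ) → (Fin n → Carrier) → Carrier → Carrier
  monicEval n cs x = pow x n + sumFin n (λ i → cs i * pow x (toℕ i))

record AlgClosureFp (c ℓ : Level) : Set (Level.suc (c ⊔ ℓ)) where
  field
    cring : CommutativeRing c ℓ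
  open CommutativeRing cring public hiding (ring)
  open RingUtil cring public
  field
    p          : ℕ
    p-prime    : Prime p
    char-p     : natK p ≈ 0#
    nontrivial : ¬ (1# ≈ 0#)
    inverse    : ∀ x → ¬ (x ≈ 0#) → Σ Carrier (λ y → x * y ≈ 1#)
    alg-closed : ∀ (n : ℕ) → 1 ≤ n → (cs : Fin n → Carrier) →
                 Σ Carrier (λ x → monicEval n cs x ≈ 0#)
    algebraic  : ∀ x → Σ ℕ (λ n → pow x (ℕ._^_ p (suc n)) ≈ x)

  -- Frobenius x ↦ x^p and its inverse x ↦ x^(p^(n-1)) where x^(p^n) = x
  σ : Carrier → Carrier
  σ x = pow x p

  σ⁻¹ : Carrier → Carrier
  σ⁻¹ x with algebraic x
  ... | n , _ = pow x (ℕ._^_ p n)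

-- Basis e_{i,j}: i ∈ Fin 2 (0 ↦ 1, 1 ↦ 2),
-- j ∈ Fin q (toℕ j + 1 is the paper's index j).  The actions of F and V
-- on basis vectors are given with 1-based natural indices.

Lbl : Set
Lbl = Fin 2 × ℕ   -- (i, j) with 1-based j

lbl1 lbl2 : ℕ → Maybe Lbl
lbl1 j = just (fzero , j)
lbl2 j = just (fsuc fzero , j)

Fbasis : (q u v : ℕ) → Fin 2 → ℕ → Maybe Lbl
Fbasis q u v fzero j =
  if (j ≡ᵇ u) ∨ (j ≡ᵇ v) then nothing
  else if j <ᵇ u then lbl2 j
  else if j <ᵇ v then lbl2 (j ∸ 1)
  else lbl2 (j ∸ 2)
Fbasis q u v (fsuc _) j =
  if j ≡ᵇ (q ∸ v ℕ.+ 1) then lbl1 1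
  else if j ≡ᵇ (q ∸ u ℕ.+ 1) then lbl1 2
  else nothing

Vbasis : (q u v : ℕ) → Fin 2 → ℕ → Maybe Lbl
Vbasis q u v fzero j =
  if (j ≡ᵇ 1) ∨ (j ≡ᵇ 2) then nothing
  else if j <ᵇ (q ∸ v ℕ.+ 3) then lbl2 (j ∸ 2)
  else if j <ᵇ (q ∸ u ℕ.+ 2) then lbl2 (j ∸ 1)
  else lbl2 j
Vbasis q u v (fsuc _) j =
  if j ≡ᵇ (q ∸ 1) then lbl1 u
  else if j ≡ᵇ q then lbl1 v
  else nothing

finEqᵇ : Fin 2 → Fin 2 → Bool
finEqᵇ a b = toℕ a ≡ᵇ toℕ b

hits : Maybe Lbl → Fin 2 → ℕ → Bool
hits nothing i' j' = false
hits (just (i , j)) i' j' = finEqᵇ i i' ∧ (j ≡ᵇ j')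

module Module {c ℓ} (K : AlgClosureFp c ℓ) (q u v : ℕ) where
  open AlgClosureFp K

  -- elements of M: coordinates with respect to the basis e_{i,j}
  M : Set c
  M = Fin 2 → Fin q → Carrier

  _≈M_ : M → M → Set ℓ
  x ≈M y = ∀ i j → x i j ≈ y i j

  0M : M
  0M i j = 0#

  _+M_ : M → M → M
  (x +M y) i j = x i j + y i j

  _·M_ : Carrier → M → M
  (a ·M x) i j = a * x i j

  sumM : (n : ℕ) → (Fin n → M) → M
  sumM n f i j = sumFin n (λ l → f l i j)

  sumB : (Fin 2 → Fin q → Carrier) → Carrier
  sumB g = sumFin 2 (λ i → sumFin q (λ j → g i j))

  -- Frobenius-semilinear F and Frobenius⁻¹-semilinear V extending the
  -- given action on the basis
  F : M → M
  F x i' j' = sumB (λ i j →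
    if hits (Fbasis q u v i (suc (toℕ j))) i' (suc (toℕ j')) then σ (x i j) else 0#)

  V : M → M
  V x i' j' = sumB (λ i j →
    if hits (Vbasis q u v i (suc (toℕ j))) i' (suc (toℕ j')) then σ⁻¹ (x i j) else 0#)

  iter : ℕ → (M → M) → M → M
  iter zero f x = x
  iter (suc n) f x = f (iter n f x)

  FNilpotent : Set (c ⊔ ℓ)
  FNilpotent = Σ ℕ (λ n → ∀ x → iter n F x ≈M 0M)

  Sub : Set (Level.suc (c ⊔ ℓ))
  Sub = M → Set (c ⊔ ℓ)

  LinIndep : (d : ℕ) → (Fin d → M) → Set (c ⊔ ℓ)
  LinIndep d g = ∀ (a : Fin d → Carrier) → sumM d (λ l → a l ·M g l) ≈M 0M → ∀ l → a l ≈ 0#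

  Span : (d : ℕ) → (Fin d → M) → Sub
  Span d g x = Σ (Fin d → Carrier) (λ a → x ≈M sumM d (λ l → a l ·M g l))

  HasDim : Sub → ℕ → Set (c ⊔ ℓ)
  HasDim S d = Σ (Fin d → M) (λ g → LinIndep d g × (∀ l → S (g l))
                 × (∀ x → S x → Span d g x) × (∀ x → Span d g x → S x))

  SameSub : Sub → Sub → Set (c ⊔ ℓ)
  SameSub S T = ∀ x → (S x → T x) × (T x → S x)

  -- Full flags 0 = W_0 ⊂ … ⊂ W_{2q} = M are given by an ordered basis
  -- f_1,…,f_{2q} of M, with W_j = span(f_1,…,f_j).
  IsBasis : (Fin (2 ℕ.* q) → M) → Set (c ⊔ ℓ)
  IsBasis f = LinIndep (2 ℕ.* q) f × (∀ x → Span (2 ℕ.* q) f x)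

  W : (Fin (2 ℕ.* q) → M) → ℕ → Sub
  W f j x = Σ (Fin (2 ℕ.* q) → Carrier) (λ a →
    (∀ l → j ≤ toℕ l → a l ≈ 0#) × (x ≈M sumM (2 ℕ.* q) (λ l → a l ·M f l)))

  ImF : Sub → Sub
  ImF S y = Σ M (λ x → S x × (F x ≈M y))

  PreV : Sub → Sub
  PreV S x = S (V x)

  InFlag : (Fin (2 ℕ.* q) → M) → Sub → Set (c ⊔ ℓ)
  InFlag f S = Σ ℕ (λ l → l ≤ 2 ℕ.* q × SameSub S (W f l))

  IsFinal : (Fin (2 ℕ.* q) → M) → Set (c ⊔ ℓ)
  IsFinal f = IsBasis f ×
    (∀ j → j ≤ 2 ℕ.* q → InFlag f (ImF (W f j)) × InFlag f (PreV (W f j)))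

  KerF : Sub
  KerF x = Level.Lift c (F x ≈M 0M)

  WKer : (Fin (2 ℕ.* q) → M) → ℕ → Sub
  WKer f j x = W f j x × KerF x

  -- η(j) = η(j-1) + 1   (for 1 ≤ j ≤ 2q), η(j) = dim(W_j ∩ ker F)
  EtaIncr : (Fin (2 ℕ.* q) → M) → ℕ → Set (c ⊔ ℓ)
  EtaIncr f j = Σ ℕ (λ d → HasDim (WKer f (j ∸ 1)) d × HasDim (WKer f j) (suc d))

  data Count (P : ℕ → Set (c ⊔ ℓ)) : ℕ → ℕ → Set (c ⊔ ℓ) where
    c-zero : Count P 0 0
    c-yes  : ∀ {j n} → P (suc j) → Count P j n → Count P (suc j) (suc n)
    c-no   : ∀ {j n} → ¬ P (suc j) → Count P j n → Count P (suc j) n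

  -- ω(j) = k for the Siegel EO permutation computed from the flag f:
  -- ω(j_l) = l, ω(i_m) = q + m.
  Omega : (Fin (2 ℕ.* q) → M) → ℕ → ℕ → Set (c ⊔ ℓ)
  Omega f j k =
    (EtaIncr f j × Count (EtaIncr f) j k) ⊎
    (¬ EtaIncr f j × Σ ℕ (λ m → Count (λ i → ¬ EtaIncr f i) j m × k ≡ q ℕ.+ m))

{-# OPTIONS --safe #-}
-- F sends every basis vector e_{i,j} to a basis vector or to 0, and no two basis vectors
-- to the same one; so up to Frobenius twists F is a partial permutation of the basis. Its
-- only cycles are e_{1,1} ⇄ e_{2,1} when u ≥ 2 and v = q, together with e_{1,2} ⇄ e_{2,2}
-- when moreover q = u + 1. A weight on the basis that increases along F away from the
-- cycles shows that F⁶ vanishes off them: F is nilpotent when there is no cycle, and in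
-- any case ker F ∩ F⁶(M) = 0, because F permutes the cycle vectors.
--
-- ω(1) = 1 says that W₁ = k·f₀ lies in ker F. If F is nilpotent, the flag member F(W₁)
-- cannot contain f₀ (f₀ would be a multiple of F f₀, hence of every Fⁿ f₀), so it is 0.
-- If F has a cycle, the flag member F⁶(M) contains the periodic vector e_{1,1} ≠ 0, hence
-- contains W₁, and W₁ ⊆ ker F ∩ F⁶(M) = 0 is impossible.
module Submission where

open import Defs
open import Level using (Lift; lift; lower; _⊔_)
open import Data.Nat using (ℕ; zero; suc; _≤_; _<_; _∸_; _≡ᵇ_; _<ᵇ_; z≤n; s≤s)
import Data.Nat as ℕ
import Data.Nat.Properties as ℕₚ
open import Data.Nat.Primality using (prime⇒nonZero)
open import Data.Fin using (Fin; toℕ; punchIn; _≟_) renaming (zero to fzero; suc to fsuc)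
import Data.Fin.Properties as Finₚ
open import Data.Bool using (Bool; true; false; T; if_then_else_)
open import Data.Bool.Properties using (T-≡; ¬-not)
open import Data.Maybe using (just)
import Data.Maybe.Properties as Maybeₚ
open import Data.Product using (Σ; _×_; _,_; proj₁; proj₂)
open import Data.Sum using (_⊎_; inj₁; inj₂)
open import Data.Unit using (⊤)
open import Data.Vec.Functional using (_∷_; replicate)
open import Function using (_∘_; Equivalence)
open import Relation.Nullary using (¬_; contradiction; Dec; yes; no; _×-dec_; _⊎-dec_)
open import Relation.Binary using (Setoid)
import Relation.Binary.PropositionalEquality as ≡
open ≡ using (_≡_; _≢_)
open import Algebra.Bundles using (CommutativeRing)
import Algebra.Properties.CommutativeSemiring.Exp as Exp
import Algebra.Properties.Semiring.Sum as Sum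
import Algebra.Properties.Monoid.Mult as Mult
import Data.Vec.Functional.Relation.Binary.Equality.Setoid as Pointwise

private
  variable
    b : Bool

module RingUtilProperties {c ℓ} (R : CommutativeRing c ℓ) where
  open CommutativeRing R
  open RingUtil R
  open Exp commutativeSemiring using (_^_)
  open Sum semiring using (sum; sum-cong-≋; sum-replicate-zero; sum-remove; *-distribˡ-sum)
  open import Relation.Binary.Reasoning.Setoid setoid

  pow≡^ : ∀ x n → pow x n ≡ x ^ n
  pow≡^ x zero    = ≡.refl
  pow≡^ x (suc n) = ≡.cong (x *_) (pow≡^ x n)

  sumFin≡sum : ∀ n (g : Fin n → Carrier) → sumFin n g ≡ sum g
  sumFin≡sum zero    g = ≡.refl
  sumFin≡sum (suc n) g = ≡.cong (g fzero +_) (sumFin≡sum n (g ∘ fsuc))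

  sumFin-cong : ∀ n {g h : Fin n → Carrier} → (∀ i → g i ≈ h i) → sumFin n g ≈ sumFin n h
  sumFin-cong n {g} {h} g≈h rewrite sumFin≡sum n g | sumFin≡sum n h = sum-cong-≋ g≈h

  sumFin-zero : ∀ n {g : Fin n → Carrier} → (∀ i → g i ≈ 0#) → sumFin n g ≈ 0#
  sumFin-zero n {g} g≈0 rewrite sumFin≡sum n g = trans (sum-cong-≋ g≈0) (sum-replicate-zero n)

  sumFin-single : ∀ n {g : Fin n → Carrier} k → (∀ i → i ≢ k → g i ≈ 0#) → sumFin n g ≈ g k
  sumFin-single (suc n) {g} k g≈0 rewrite sumFin≡sum (suc n) g = begin
    sum g                              ≈⟨ sum-remove {i = k} g ⟩
    g k + sum (λ i → g (punchIn k i))  ≈⟨ +-congˡ rest≈0 ⟩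
    g k + 0#                           ≈⟨ +-identityʳ (g k) ⟩
    g k                                ∎
    where
    rest≈0 : sum (λ i → g (punchIn k i)) ≈ 0#
    rest≈0 = trans (sum-cong-≋ (λ i → g≈0 _ (Finₚ.punchInᵢ≢i k i))) (sum-replicate-zero n)

  *-distribˡ-sumFin : ∀ n a (g : Fin n → Carrier) → a * sumFin n g ≈ sumFin n (λ i → a * g i)
  *-distribˡ-sumFin n a g rewrite sumFin≡sum n g | sumFin≡sum n (λ i → a * g i) = *-distribˡ-sum a g

module FrobeniusOnK {c ℓ} (K : AlgClosureFp c ℓ) where
  open AlgClosureFp K
  open RingUtilProperties cring using (pow≡^)
  open Exp commutativeSemiring using (_^_; ^-congˡ; ^-assocʳ; ^-distrib-*)
  open import Relation.Binary.Reasoning.Setoid setoid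

  σ-cong : ∀ {x y} → x ≈ y → σ x ≈ σ y
  σ-cong {x} {y} x≈y rewrite pow≡^ x p | pow≡^ y p = ^-congˡ p x≈y

  σ-* : ∀ x y → σ (x * y) ≈ σ x * σ y
  σ-* x y rewrite pow≡^ (x * y) p | pow≡^ x p | pow≡^ y p = ^-distrib-* x y p

  σ-0# : σ 0# ≈ 0#
  σ-0# with p | prime⇒nonZero p-prime
  ... | suc _ | _ = zeroˡ _

  σ-1# : σ 1# ≈ 1#
  σ-1# rewrite pow≡^ 1# p = ×-idem (*-identityˡ 1#) p
    where open Mult *-monoid using (×-idem)
          instance _ = prime⇒nonZero p-prime

  0^m≈0 : ∀ {m} → 0 < m → 0# ^ m ≈ 0#
  0^m≈0 {suc _} _ = zeroˡ _

  σx≈0⇒x≈0 : ∀ {x} → σ x ≈ 0# → x ≈ 0#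
  σx≈0⇒x≈0 {x} σx≈0 with algebraic x
  ... | n , x^pⁿ⁺¹≈x = begin
    x                    ≈⟨ x^pⁿ⁺¹≈x ⟨
    pow x (p ℕ.^ suc n)  ≡⟨ pow≡^ x (p ℕ.^ suc n) ⟩
    x ^ (p ℕ.* p ℕ.^ n)  ≈⟨ ^-assocʳ x p (p ℕ.^ n) ⟨
    (x ^ p) ^ (p ℕ.^ n)  ≈⟨ ^-congˡ (p ℕ.^ n) (≡.subst (_≈ 0#) (pow≡^ x p) σx≈0) ⟩
    0# ^ (p ℕ.^ n)       ≈⟨ 0^m≈0 (ℕₚ.m^n>0 p n) ⟩
    0#                   ∎
    where instance _ = prime⇒nonZero p-prime

≡true⇒T : b ≡ true → T b
≡true⇒T = Equivalence.from T-≡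

T⇒≡true : T b → b ≡ true
T⇒≡true = Equivalence.to T-≡

≡false⇒¬T : b ≡ false → ¬ T b
≡false⇒¬T b≡false = ≡.subst T b≡false

¬T⇒≡false : ¬ T b → b ≡ false
¬T⇒≡false ¬Tb = ¬-not (¬Tb ∘ ≡true⇒T)

suc≡+1⇒≡ : ∀ {m n} → suc m ≡ n ℕ.+ 1 → m ≡ n
suc≡+1⇒≡ {m} {n} e = ℕₚ.suc-injective (≡.trans e (ℕₚ.+-comm n 1))

Fbasis-row₁-target : ∀ q u v {j k i′} → Fbasis q u v fzero j ≡ just (i′ , k) →
  i′ ≡ fsuc fzero × (k ≡ j × j < u ⊎ k ≡ j ∸ 1 × u < j × j < v ⊎ k ≡ j ∸ 2 × v < j)
Fbasis-row₁-target q u v {j = j} e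
  with j ≡ᵇ u in j≡u | j ≡ᵇ v in j≡v | j <ᵇ u in j<u | j <ᵇ v in j<v
Fbasis-row₁-target q u v ≡.refl | false | false | true | _ =
  ≡.refl , inj₁ (≡.refl , ℕₚ.<ᵇ⇒< _ _ (≡true⇒T j<u))
Fbasis-row₁-target q u v {j = j} ≡.refl | false | false | false | true =
  ≡.refl , inj₂ (inj₁ (≡.refl , u<j , ℕₚ.<ᵇ⇒< _ _ (≡true⇒T j<v)))
  where
  u<j : u < j
  u<j = ℕₚ.≤∧≢⇒< (ℕₚ.≮⇒≥ (≡false⇒¬T j<u ∘ ℕₚ.<⇒<ᵇ))
                  (≡false⇒¬T j≡u ∘ ℕₚ.≡⇒≡ᵇ j u ∘ ≡.sym)
Fbasis-row₁-target q u v {j = j} ≡.refl | false | false | false | false =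
  ≡.refl , inj₂ (inj₂ (≡.refl , v<j))
  where
  v<j : v < j
  v<j = ℕₚ.≤∧≢⇒< (ℕₚ.≮⇒≥ (≡false⇒¬T j<v ∘ ℕₚ.<⇒<ᵇ))
                  (≡false⇒¬T j≡v ∘ ℕₚ.≡⇒≡ᵇ j v ∘ ≡.sym)
Fbasis-row₁-target q u v () | true | _ | _ | _
Fbasis-row₁-target q u v () | false | true | _ | _

Fbasis-row₂-target : ∀ q u v {j z t} → Fbasis q u v (fsuc z) j ≡ just t →
  t ≡ (fzero , 1) × j ≡ q ∸ v ℕ.+ 1 ⊎ t ≡ (fzero , 2) × j ≡ q ∸ u ℕ.+ 1
Fbasis-row₂-target q u v {j = j} e
  with j ≡ᵇ q ∸ v ℕ.+ 1 in first | j ≡ᵇ q ∸ u ℕ.+ 1 in second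
Fbasis-row₂-target q u v ≡.refl | true | _ = inj₁ (≡.refl , ℕₚ.≡ᵇ⇒≡ _ _ (≡true⇒T first))
Fbasis-row₂-target q u v ≡.refl | false | true = inj₂ (≡.refl , ℕₚ.≡ᵇ⇒≡ _ _ (≡true⇒T second))
Fbasis-row₂-target q u v () | false | false

-- The only label that F can send to t; on row 2 it inverts the three ranges of Fbasis on row 1.
source : (q u v : ℕ) → Fin 2 × ℕ → Fin 2 × ℕ
source q u v (fzero , 1) = fsuc fzero , q ∸ v ℕ.+ 1
source q u v (fzero , _) = fsuc fzero , q ∸ u ℕ.+ 1
source q u v (fsuc _ , k) = fzero , (if k <ᵇ u then k else if suc k <ᵇ v then suc k else suc (suc k))

Fbasis-source : ∀ q {u v i j} → u < v → ∀ {t} → Fbasis q u v i j ≡ just t → (i , j) ≡ source q u v t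
Fbasis-source q {u} {v} {fsuc fzero} {j} u<v e with Fbasis-row₂-target q u v {j} {fzero} e
... | inj₁ (≡.refl , ≡.refl) = ≡.refl
... | inj₂ (≡.refl , ≡.refl) = ≡.refl
Fbasis-source q {u} {v} {fzero} {j} u<v e with Fbasis-row₁-target q u v {j} e
... | ≡.refl , inj₁ (≡.refl , j<u)
  rewrite T⇒≡true (ℕₚ.<⇒<ᵇ j<u) = ≡.refl
Fbasis-source q {u} {v} {fzero} {suc j} u<v e
    | ≡.refl , inj₂ (inj₁ (≡.refl , u<1+j , 1+j<v))
  rewrite ¬T⇒≡false (ℕₚ.<⇒≱ u<1+j ∘ ℕₚ.<ᵇ⇒< j u)
        | T⇒≡true (ℕₚ.<⇒<ᵇ 1+j<v) = ≡.refl
Fbasis-source q {u} {v} {fzero} {suc (suc j)} u<v e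
    | ≡.refl , inj₂ (inj₂ (≡.refl , v<2+j))
  rewrite ¬T⇒≡false (ℕₚ.<⇒≱ (ℕₚ.<-≤-trans u<v (ℕₚ.≤-pred v<2+j)) ∘ ℕₚ.<ᵇ⇒< j u)
        | ¬T⇒≡false (ℕₚ.<⇒≱ v<2+j ∘ ℕₚ.<ᵇ⇒< (suc j) v) = ≡.refl
Fbasis-source q {u} {v} {fzero} {suc zero} u<v e | ≡.refl , inj₂ (inj₂ (≡.refl , s≤s v≤0))
  = contradiction (ℕₚ.≤-trans u<v v≤0) λ ()

Fbasis-row₁-below : ∀ q {u v j} → u < v → j < u → Fbasis q u v fzero j ≡ just (fsuc fzero , j)
Fbasis-row₁-below q {u} {v} {j} u<v j<u
  rewrite ¬T⇒≡false (ℕₚ.<⇒≢ j<u ∘ ℕₚ.≡ᵇ⇒≡ j u)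
        | ¬T⇒≡false (ℕₚ.<⇒≢ (ℕₚ.<-trans j<u u<v) ∘ ℕₚ.≡ᵇ⇒≡ j v)
        | T⇒≡true (ℕₚ.<⇒<ᵇ j<u) = ≡.refl

Fbasis-row₂-first : ∀ q u v {j z} → j ≡ q ∸ v ℕ.+ 1 → Fbasis q u v (fsuc z) j ≡ just (fzero , 1)
Fbasis-row₂-first q u v {j} e rewrite T⇒≡true (ℕₚ.≡⇒≡ᵇ j _ e) = ≡.refl

Fbasis-row₂-second : ∀ q u v {j z} → j ≢ q ∸ v ℕ.+ 1 → j ≡ q ∸ u ℕ.+ 1 →
                     Fbasis q u v (fsuc z) j ≡ just (fzero , 2)
Fbasis-row₂-second q u v {j} e₁ e₂
  rewrite ¬T⇒≡false (e₁ ∘ ℕₚ.≡ᵇ⇒≡ j _) | T⇒≡true (ℕₚ.≡⇒≡ᵇ j _ e₂) = ≡.refl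

HasCycle : (q u v : ℕ) → Set
HasCycle q u v = 1 < u × v ≡ q

-- Column j (1-based) of e_{1,j}, e_{2,j} lying on a cycle of F.
OnCycle : (q u v : ℕ) → ℕ → Set
OnCycle q u v j = HasCycle q u v × (j ≡ 1 ⊎ j ≡ 2 × 2 < u × q ≡ suc u)

swapRow : Fin 2 → Fin 2
swapRow fzero    = fsuc fzero
swapRow (fsuc _) = fzero

Fbasis-on-cycle : ∀ q {u v i j} → u < v → OnCycle q u v j → Fbasis q u v i j ≡ just (swapRow i , j)
Fbasis-on-cycle q {i = fzero} u<v ((1<u , _) , inj₁ ≡.refl) = Fbasis-row₁-below q u<v 1<u
Fbasis-on-cycle q {i = fzero} u<v (_ , inj₂ (≡.refl , 2<u , _)) = Fbasis-row₁-below q u<v 2<u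
Fbasis-on-cycle q {u} {i = fsuc z} u<v ((_ , ≡.refl) , inj₁ ≡.refl) =
  Fbasis-row₂-first q u q {z = z} (≡.cong (ℕ._+ 1) (≡.sym (ℕₚ.n∸n≡0 q)))
Fbasis-on-cycle _ {u} {i = fsuc z} u<v ((_ , ≡.refl) , inj₂ (≡.refl , _ , ≡.refl)) =
  Fbasis-row₂-second (suc u) u (suc u) {z = z}
    (λ 2≡1 → contradiction (≡.trans 2≡1 (≡.cong (ℕ._+ 1) (ℕₚ.n∸n≡0 u))) λ ())
    (≡.cong (ℕ._+ 1) (≡.sym (ℕₚ.m+n∸n≡m 1 u)))

-- Off the cycles, F sends e_{1,j} to e_{2,j} only if j < u and e_{2,j} to e_{1,j} only if
-- j ≥ u: tilt orders the two vectors of a column accordingly, and weight ranks column 1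
-- above column 2 above all others.
tilt : ℕ → Fin 2 → ℕ → ℕ
tilt u fzero    j = if j <ᵇ u then 0 else 1
tilt u (fsuc _) j = if j <ᵇ u then 1 else 0

weight : ℕ → Fin 2 → ℕ → ℕ
weight u i        1 = 4 ℕ.+ tilt u i 1
weight u i        2 = 2 ℕ.+ tilt u i 2
weight u fzero    _ = 0
weight u (fsuc _) _ = 1

tilt≤1 : ∀ u i j → tilt u i j ≤ 1
tilt≤1 u fzero j with j <ᵇ u
... | true  = z≤n
... | false = s≤s z≤n
tilt≤1 u (fsuc _) j with j <ᵇ u
... | true  = s≤s z≤n
... | false = z≤n

tilt-below : ∀ {u j} z → j < u → tilt u fzero j < tilt u (fsuc z) j
tilt-below {u} {j} z j<u rewrite T⇒≡true (ℕₚ.<⇒<ᵇ j<u) = s≤s z≤n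

tilt-above : ∀ {u j} z → ¬ j < u → tilt u (fsuc z) j < tilt u fzero j
tilt-above {u} {j} z j≮u rewrite ¬T⇒≡false (j≮u ∘ ℕₚ.<ᵇ⇒< j u) = s≤s z≤n

weight<6 : ∀ u i j → weight u i j < 6
weight<6 u i 1 = s≤s (ℕₚ.+-monoʳ-≤ 4 (tilt≤1 u i 1))
weight<6 u i 2 = s≤s (ℕₚ.≤-trans (ℕₚ.+-monoʳ-≤ 2 (tilt≤1 u i 2)) (ℕₚ.m≤m+n 3 2))
weight<6 u fzero    0 = s≤s z≤n
weight<6 u (fsuc _) 0 = s≤s (s≤s z≤n)
weight<6 u fzero    (suc (suc (suc _))) = s≤s z≤n
weight<6 u (fsuc _) (suc (suc (suc _))) = s≤s (s≤s z≤n)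

weight-row₁<row₂ : ∀ {u j} z → j < u → weight u fzero j < weight u (fsuc z) j
weight-row₁<row₂ {j = 0}                   z j<u = s≤s z≤n
weight-row₁<row₂ {j = 1}                   z j<u = ℕₚ.+-monoʳ-< 4 (tilt-below z j<u)
weight-row₁<row₂ {j = 2}                   z j<u = ℕₚ.+-monoʳ-< 2 (tilt-below z j<u)
weight-row₁<row₂ {j = suc (suc (suc _))}   z j<u = s≤s z≤n

column₂<column₁ : ∀ u i i′ → weight u i 2 < weight u i′ 1
column₂<column₁ u i i′ = ℕₚ.<-≤-trans (s≤s (ℕₚ.+-monoʳ-≤ 2 (tilt≤1 u i 2))) (ℕₚ.m≤m+n 4 _)

0<weight-row₂ : ∀ u z j → 0 < weight u (fsuc z) j
0<weight-row₂ u z 0                   = s≤s z≤n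
0<weight-row₂ u z 1                   = s≤s z≤n
0<weight-row₂ u z 2                   = s≤s z≤n
0<weight-row₂ u z (suc (suc (suc _))) = s≤s z≤n

¬OnCycle-beyond : ∀ q u v j → ¬ OnCycle q u v (3 ℕ.+ j)
¬OnCycle-beyond q u v j (_ , inj₁ ())
¬OnCycle-beyond q u v j (_ , inj₂ (() , _))

weight-increases : ∀ q {u v i j i′ k} → u < v → v ≤ q →
  Fbasis q u v i (suc j) ≡ just (i′ , suc k) → ¬ OnCycle q u v (suc k) →
  ¬ OnCycle q u v (suc j) × weight u i (suc j) < weight u i′ (suc k)
weight-increases q {u} {v} {fzero} {j} u<v v≤q e off with Fbasis-row₁-target q u v {suc j} e
... | ≡.refl , inj₁ (≡.refl , 1+j<u) = off , weight-row₁<row₂ fzero 1+j<u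
weight-increases q {u} {v} {fzero} {j = 1} {k = 0} u<v v≤q e off
    | ≡.refl , inj₂ (inj₁ (≡.refl , u<2 , _)) =
  (λ { (_ , inj₂ (_ , 2<u , _)) → ℕₚ.<-asym u<2 2<u }) , column₂<column₁ u fzero (fsuc fzero)
weight-increases q {u} {v} {fzero} {j = suc (suc m)} {k = suc m} u<v v≤q e off
    | ≡.refl , inj₂ (inj₁ (≡.refl , _)) =
  ¬OnCycle-beyond q u v m , 0<weight-row₂ u fzero (suc (suc m))
weight-increases q {u} {v} {fzero} {j = suc (suc m)} {k = m} u<v v≤q e off
    | ≡.refl , inj₂ (inj₂ (≡.refl , _)) =
  ¬OnCycle-beyond q u v m , 0<weight-row₂ u fzero (suc m)
weight-increases q {u} {v} {fsuc z} {j} u<v v≤q e off with Fbasis-row₂-target q u v {suc j} {z} e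
... | inj₁ (≡.refl , 1+j≡) with j | suc≡+1⇒≡ 1+j≡
...   | zero | 0≡q∸v = off , ℕₚ.+-monoʳ-< 4 (tilt-above z (λ 1<u → off ((1<u , v≡q) , inj₁ ≡.refl)))
  where v≡q = ℕₚ.≤-antisym v≤q (ℕₚ.m∸n≡0⇒m≤n (≡.sym 0≡q∸v))
...   | suc zero | 1≡q∸v =
  (λ { ((_ , ≡.refl) , _) → contradiction (≡.trans 1≡q∸v (ℕₚ.n∸n≡0 q)) λ () }) ,
  column₂<column₁ u (fsuc z) fzero
...   | suc (suc j) | _ = ¬OnCycle-beyond q u v j , s≤s (ℕₚ.m≤m+n 1 _)
weight-increases q {u} {v} {fsuc z} {j} u<v v≤q e off
    | inj₂ (≡.refl , 1+j≡) with j | suc≡+1⇒≡ 1+j≡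
...   | zero | 0≡q∸u =
  contradiction (ℕₚ.<-≤-trans u<v v≤q) (ℕₚ.≤⇒≯ (ℕₚ.m∸n≡0⇒m≤n (≡.sym 0≡q∸u)))
...   | suc zero | 1≡q∸u = off , ℕₚ.+-monoʳ-< 2 (tilt-above z (λ 2<u → off (on-cycle 2<u)))
  where
  u≤q = ℕₚ.<⇒≤ (ℕₚ.<-≤-trans u<v v≤q)
  q≡1+u : q ≡ suc u
  q≡1+u = ≡.trans (≡.sym (ℕₚ.m∸n+n≡m u≤q)) (≡.cong (ℕ._+ u) (≡.sym 1≡q∸u))
  on-cycle : 2 < u → OnCycle q u v 2
  on-cycle 2<u =
    (ℕₚ.<-trans (s≤s (s≤s z≤n)) 2<u , ℕₚ.≤-antisym v≤q (≡.subst (_≤ v) (≡.sym q≡1+u) u<v)) ,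
    inj₂ (≡.refl , 2<u , q≡1+u)
...   | suc (suc j) | _ = ¬OnCycle-beyond q u v j , s≤s (ℕₚ.m≤m+n 1 _)

HasCycle? : ∀ q u v → Dec (HasCycle q u v)
HasCycle? q u v = 1 ℕ.<? u ×-dec v ℕ.≟ q

OnCycle? : ∀ q u v j → Dec (OnCycle q u v j)
OnCycle? q u v j = HasCycle? q u v ×-dec (j ℕ.≟ 1 ⊎-dec (j ℕ.≟ 2 ×-dec 2 ℕ.<? u ×-dec q ℕ.≟ suc u))

module FrobeniusOnM {c ℓ} (K : AlgClosureFp c ℓ) (q u v : ℕ) where
  open AlgClosureFp K
  open RingUtilProperties cring
  open FrobeniusOnK K
  open Module K q u v

  M-setoid : Setoid c ℓ
  M-setoid = Pointwise.≋-setoid (Pointwise.≋-setoid setoid q) 2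

  open Setoid M-setoid public using () renaming (refl to ≈M-refl; sym to ≈M-sym; trans to ≈M-trans)

  col : Fin q → ℕ
  col j = suc (toℕ j)

  col-injective : ∀ {j k} → col j ≡ col k → j ≡ k
  col-injective = Finₚ.toℕ-injective ∘ ℕₚ.suc-injective

  sumB-cong : ∀ {g h : Fin 2 → Fin q → Carrier} → (∀ i j → g i j ≈ h i j) → sumB g ≈ sumB h
  sumB-cong {g} {h} g≈h = sumFin-cong 2 {sumFin q ∘ g} {sumFin q ∘ h} (λ i → sumFin-cong q (g≈h i))

  sumB-zero : ∀ {g : Fin 2 → Fin q → Carrier} → (∀ i j → g i j ≈ 0#) → sumB g ≈ 0#
  sumB-zero {g} g≈0 = sumFin-zero 2 {sumFin q ∘ g} (λ i → sumFin-zero q (g≈0 i))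

  sumB-single : ∀ {g : Fin 2 → Fin q → Carrier} i j → (∀ i′ j′ → ¬ (i′ ≡ i × j′ ≡ j) → g i′ j′ ≈ 0#) →
                sumB g ≈ g i j
  sumB-single {g} i j g≈0 =
    trans (sumFin-single 2 {sumFin q ∘ g} i (λ i′ i′≢i → sumFin-zero q (λ j′ → g≈0 i′ j′ (i′≢i ∘ proj₁))))
          (sumFin-single q j (λ j′ j′≢j → g≈0 i j′ (j′≢j ∘ proj₂)))

  *-distribˡ-sumB : ∀ a (g : Fin 2 → Fin q → Carrier) → a * sumB g ≈ sumB (λ i j → a * g i j)
  *-distribˡ-sumB a g =
    trans (*-distribˡ-sumFin 2 a (sumFin q ∘ g)) (sumFin-cong 2 (λ i → *-distribˡ-sumFin q a (g i)))

  if-cong : ∀ b {x y} → x ≈ y → (if b then x else 0#) ≈ (if b then y else 0#)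
  if-cong true  x≈y = x≈y
  if-cong false _   = refl

  if-* : ∀ b a x → (if b then a * x else 0#) ≈ a * (if b then x else 0#)
  if-* true  a x = refl
  if-* false a x = sym (zeroʳ a)

  hits⇒≡ : ∀ m i j → hits m i j ≡ true → m ≡ just (i , j)
  hits⇒≡ (just (fzero , j′))      fzero        j e = ≡.cong (λ k → just (fzero , k)) (ℕₚ.≡ᵇ⇒≡ j′ j (≡true⇒T e))
  hits⇒≡ (just (fsuc fzero , j′)) (fsuc fzero) j e =
    ≡.cong (λ k → just (fsuc fzero , k)) (ℕₚ.≡ᵇ⇒≡ j′ j (≡true⇒T e))

  hits-just : ∀ i j → hits (just (i , j)) i j ≡ true
  hits-just fzero        j = T⇒≡true (ℕₚ.≡⇒≡ᵇ j j ≡.refl)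
  hits-just (fsuc fzero) j = T⇒≡true (ℕₚ.≡⇒≡ᵇ j j ≡.refl)

  F-cong : ∀ {x y} → x ≈M y → F x ≈M F y
  F-cong x≈y i′ k =
    sumB-cong (λ i j → if-cong (hits (Fbasis q u v i (col j)) i′ (col k)) (σ-cong (x≈y i j)))

  F-semilinear : ∀ a x → F (a ·M x) ≈M (σ a ·M F x)
  F-semilinear a x i′ k =
    trans (sumB-cong (λ i j → trans (if-cong (edge i j) (σ-* a (x i j))) (if-* (edge i j) (σ a) _)))
          (sym (*-distribˡ-sumB (σ a) (λ i j → if edge i j then σ (x i j) else 0#)))
    where
    edge : Fin 2 → Fin q → Bool
    edge i j = hits (Fbasis q u v i (col j)) i′ (col k)

  F-vanishes-at : ∀ {x i′ k} → (∀ i j → Fbasis q u v i (col j) ≡ just (i′ , col k) → x i j ≈ 0#) →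
                  F x i′ k ≈ 0#
  F-vanishes-at {x} {i′} {k} x≈0 = sumB-zero term≈0
    where
    term≈0 : ∀ i j → (if hits (Fbasis q u v i (col j)) i′ (col k) then σ (x i j) else 0#) ≈ 0#
    term≈0 i j with hits (Fbasis q u v i (col j)) i′ (col k) in edge
    ... | true  = trans (σ-cong (x≈0 i j (hits⇒≡ _ i′ (col k) edge))) σ-0#
    ... | false = refl

  F-zero : ∀ {x} → x ≈M 0M → F x ≈M 0M
  F-zero x≈0 i′ k = F-vanishes-at (λ i j _ → x≈0 i j)

  basis : Fin 2 → Fin q → M
  basis i₀ j₀ i j with i₀ ≟ i | j₀ ≟ j
  ... | yes _ | yes _ = 1#
  ... | _     | _     = 0#

  basis-diag : ∀ i j → basis i j i j ≈ 1#
  basis-diag i j with i ≟ i | j ≟ j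
  ... | yes _  | yes _  = refl
  ... | no i≢i | _      = contradiction ≡.refl i≢i
  ... | yes _  | no j≢j = contradiction ≡.refl j≢j

  basis-off : ∀ {i₀ j₀ i j} → ¬ (i ≡ i₀ × j ≡ j₀) → basis i₀ j₀ i j ≈ 0#
  basis-off {i₀} {j₀} {i} {j} ≢ with i₀ ≟ i | j₀ ≟ j
  ... | yes ≡.refl | yes ≡.refl = contradiction (≡.refl , ≡.refl) ≢
  ... | yes _      | no _       = refl
  ... | no _       | _          = refl

  basis≉0 : ∀ i j → ¬ basis i j ≈M 0M
  basis≉0 i j basis≈0 = nontrivial (trans (sym (basis-diag i j)) (basis≈0 i j))

  combination-head : ∀ {n} (a : Fin (suc n) → Carrier) (g : Fin (suc n) → M) →
                     (∀ l → l ≢ fzero → a l ≈ 0#) → sumM (suc n) (λ l → a l ·M g l) ≈M (a fzero ·M g fzero)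
  combination-head a g a≈0 i j =
    sumFin-single _ fzero (λ l l≢0 → trans (*-congʳ (a≈0 l l≢0)) (zeroˡ (g l i j)))

  head-only : ∀ {n} → Carrier → Fin (suc n) → Carrier
  head-only {n} b = b ∷ replicate n 0#

  head-only-tail : ∀ {n} b (l : Fin (suc n)) → l ≢ fzero → head-only b l ≈ 0#
  head-only-tail b fzero    l≢0 = contradiction ≡.refl l≢0
  head-only-tail b (fsuc l) _   = refl

  LinIndep-head : ∀ {d g} → LinIndep (suc d) g → ∀ b → (b ·M g fzero) ≈M 0M → b ≈ 0#
  LinIndep-head {g = g} independent b bg₀≈0 =
    independent (head-only b) (≈M-trans (combination-head (head-only b) g (head-only-tail b)) bg₀≈0) fzero

  LinIndep-head≉0 : ∀ {d g} → LinIndep (suc d) g → ¬ g fzero ≈M 0M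
  LinIndep-head≉0 {g = g} independent g₀≈0 =
    nontrivial (LinIndep-head {g = g} independent 1# (λ i j → trans (*-identityˡ _) (g₀≈0 i j)))

  F-image : ℕ → Sub
  F-image zero    = λ _ → Lift (c ⊔ ℓ) ⊤
  F-image (suc n) = ImF (F-image n)

  F-image⇒iterate : ∀ n {x} → F-image n x → Σ M λ y → x ≈M iter n F y
  F-image⇒iterate zero    {x} _                 = x , ≈M-refl
  F-image⇒iterate (suc n)     (z , z∈ , Fz≈x) =
    let y , z≈Fⁿy = F-image⇒iterate n z∈ in y , ≈M-trans (≈M-sym Fz≈x) (F-cong z≈Fⁿy)

  periodic∈F-image : ∀ {x} → F (F x) ≈M x → ∀ n → F-image n x × F-image n (F x)
  periodic∈F-image FFx≈x zero    = _ , _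
  periodic∈F-image {x} FFx≈x (suc n) =
    let x∈ , Fx∈ = periodic∈F-image FFx≈x n in (F x , Fx∈ , FFx≈x) , (x , x∈ , ≈M-refl)

  x≈a·Fx⇒x≈0 : FNilpotent → ∀ {a x} → x ≈M (a ·M F x) → x ≈M 0M
  x≈a·Fx⇒x≈0 (N , F^N≈0) {a} {x} x≈aFx i j =
    let s , x≈sFᴺx = multiple-of-iterate N in
    trans (x≈sFᴺx i j) (trans (*-congˡ (F^N≈0 x i j)) (zeroʳ s))
    where
    step : ∀ n → Σ Carrier λ b → iter n F x ≈M (b ·M iter (suc n) F x)
    step zero    = a , x≈aFx
    step (suc n) = let b , e = step n in σ b , ≈M-trans (F-cong e) (F-semilinear b (iter (suc n) F x))
    multiple-of-iterate : ∀ n → Σ Carrier λ s → x ≈M (s ·M iter n F x)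
    multiple-of-iterate zero    = 1# , λ i j → sym (*-identityˡ _)
    multiple-of-iterate (suc n) =
      let s , e = multiple-of-iterate n ; b , e′ = step n in
      s * b , λ i j → trans (e i j) (trans (*-congˡ (e′ i j)) (sym (*-assoc s b (iter (suc n) F x i j))))

  same-target : ∀ {i j s t} → Fbasis q u v i j ≡ just s → Fbasis q u v i j ≡ just t → s ≡ t
  same-target e₁ e₂ = Maybeₚ.just-injective (≡.trans (≡.sym e₁) e₂)

  module _ (u<v : u < v) (v≤q : v ≤ q) where

    F-at-source : ∀ {x i j i′ k} → Fbasis q u v i (col j) ≡ just (i′ , col k) → F x i′ k ≈ σ (x i j)
    F-at-source {x} {i} {j} {i′} {k} e = trans (sumB-single i j others≈0) at-source
      where
      others≈0 : ∀ i₁ j₁ → ¬ (i₁ ≡ i × j₁ ≡ j) →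
                 (if hits (Fbasis q u v i₁ (col j₁)) i′ (col k) then σ (x i₁ j₁) else 0#) ≈ 0#
      others≈0 i₁ j₁ ≢ with hits (Fbasis q u v i₁ (col j₁)) i′ (col k) in edge
      ... | false = refl
      ... | true  = contradiction (≡.cong proj₁ same , col-injective (≡.cong proj₂ same)) ≢
        where
        same : (i₁ , col j₁) ≡ (i , col j)
        same = ≡.trans (Fbasis-source q u<v (hits⇒≡ _ i′ (col k) edge)) (≡.sym (Fbasis-source q u<v e))
      at-source : (if hits (Fbasis q u v i (col j)) i′ (col k) then σ (x i j) else 0#) ≈ σ (x i j)
      at-source rewrite e | hits-just i′ (col k) = refl

    F-basis : ∀ {i j i′ k} → Fbasis q u v i (col j) ≡ just (i′ , col k) → F (basis i j) ≈M basis i′ k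
    F-basis {i} {j} {i′} {k} e i₁ k₁ with i′ ≟ i₁ | k ≟ k₁
    ... | yes ≡.refl | yes ≡.refl =
      trans (F-at-source {basis i j} e) (trans (σ-cong (basis-diag i j)) σ-1#)
    ... | no i′≢i₁ | _ = F-vanishes-at {basis i j} λ i₂ j₂ e₁ → basis-off {i} {j} {i₂} {j₂}
      λ { (≡.refl , ≡.refl) → i′≢i₁ (≡.cong proj₁ (same-target {i} {col j} e e₁)) }
    ... | yes _ | no k≢k₁ = F-vanishes-at {basis i j} λ i₂ j₂ e₁ → basis-off {i} {j} {i₂} {j₂}
      λ { (≡.refl , ≡.refl) → k≢k₁ (col-injective (≡.cong proj₂ (same-target {i} {col j} e e₁))) }

    iterate-vanishes-off-cycle : ∀ n x i j → ¬ OnCycle q u v (col j) → weight u i (col j) < n →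
                                 iter n F x i j ≈ 0#
    iterate-vanishes-off-cycle (suc n) x i′ k off w<1+n = F-vanishes-at λ i j e →
      let off′ , w<w′ = weight-increases q u<v v≤q e off in
      iterate-vanishes-off-cycle n x i j off′ (ℕₚ.<-≤-trans w<w′ (ℕₚ.≤-pred w<1+n))

    acyclic⇒nilpotent : ¬ HasCycle q u v → FNilpotent
    acyclic⇒nilpotent acyclic =
      6 , λ x i j → iterate-vanishes-off-cycle 6 x i j (acyclic ∘ proj₁) (weight<6 u i (col j))

    ker-F∩im-F⁶≈0 : ∀ {g} y → g ≈M iter 6 F y → F g ≈M 0M → g ≈M 0M
    ker-F∩im-F⁶≈0 {g} y g≈F⁶y Fg≈0 i j with OnCycle? q u v (col j)
    ... | no off = trans (g≈F⁶y i j) (iterate-vanishes-off-cycle 6 y i j off (weight<6 u i (col j)))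
    ... | yes on =
      σx≈0⇒x≈0 (trans (sym (F-at-source {g} (Fbasis-on-cycle q {i = i} u<v on))) (Fg≈0 (swapRow i) j))

    basis-on-cycle-periodic : ∀ {j} → OnCycle q u v (col j) → F (F (basis fzero j)) ≈M basis fzero j
    basis-on-cycle-periodic {j} on =
      ≈M-trans (F-cong (F-basis {fzero} {j} {fsuc fzero} {j} (Fbasis-on-cycle q u<v on)))
               (F-basis {fsuc fzero} {j} {fzero} {j} (Fbasis-on-cycle q {i = fsuc fzero} u<v on))

module FinalFlag {c ℓ} (K : AlgClosureFp c ℓ) (r u v : ℕ)
                 (f : Fin (2 ℕ.* suc r) → Module.M K (suc r) u v)
                 (final : Module.IsFinal K (suc r) u v f) where
  open AlgClosureFp K
  open RingUtilProperties cring
  open Module K (suc r) u v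
  open FrobeniusOnM K (suc r) u v

  f₀ : M
  f₀ = f fzero

  independent : LinIndep (2 ℕ.* suc r) f
  independent = proj₁ (proj₁ final)

  f₀≉0 : ¬ f₀ ≈M 0M
  f₀≉0 = LinIndep-head≉0 {g = f} independent

  W₀≈0 : ∀ {x} → W f 0 x → x ≈M 0M
  W₀≈0 (a , a≈0 , x≈) i j =
    trans (x≈ i j) (sumFin-zero _ (λ l → trans (*-congʳ (a≈0 l z≤n)) (zeroˡ (f l i j))))

  ≈0⇒W : ∀ {j x} → x ≈M 0M → W f j x
  ≈0⇒W x≈0 = (λ _ → 0#) , (λ _ _ → refl) ,
    λ i j → trans (x≈0 i j) (sym (sumFin-zero (2 ℕ.* suc r) (λ l → zeroˡ (f l i j))))

  W-mono : ∀ {j k x} → j ≤ k → W f j x → W f k x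
  W-mono j≤k (a , a≈0 , x≈) = a , (λ l k≤l → a≈0 l (ℕₚ.≤-trans j≤k k≤l)) , x≈

  W-top : ∀ x → W f (2 ℕ.* suc r) x
  W-top x = let a , x≈ = proj₂ (proj₁ final) x in
    a , (λ l 2q≤l → contradiction 2q≤l (ℕₚ.<⇒≱ (Finₚ.toℕ<n l))) , x≈

  W₁⇒multiple : ∀ {x} → W f 1 x → Σ Carrier λ b → x ≈M (b ·M f₀)
  W₁⇒multiple (a , a≈0 , x≈) = a fzero , ≈M-trans x≈ (combination-head a f tail≈0)
    where
    tail≈0 : ∀ l → l ≢ fzero → a l ≈ 0#
    tail≈0 fzero    l≢0 = contradiction ≡.refl l≢0
    tail≈0 (fsuc l) _   = a≈0 (fsuc l) (s≤s z≤n)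

  multiple⇒W₁ : ∀ {x b} → x ≈M (b ·M f₀) → W f 1 x
  multiple⇒W₁ {b = b} x≈bf₀ =
    head-only b , tail≈0 , ≈M-trans x≈bf₀ (≈M-sym (combination-head (head-only b) f (head-only-tail b)))
    where
    tail≈0 : ∀ l → 1 ≤ toℕ l → head-only b l ≈ 0#
    tail≈0 (fsuc l) _ = refl

  f₀∈W₁ : W f 1 f₀
  f₀∈W₁ = multiple⇒W₁ (λ i j → sym (*-identityˡ _))

  nilpotent⇒F-kills-f₀ : FNilpotent → F f₀ ≈M 0M
  nilpotent⇒F-kills-f₀ nilpotent with proj₁ (proj₂ final 1 (s≤s z≤n))
  ... | zero , _ , F[W₁]≈W₀ = W₀≈0 (proj₁ (F[W₁]≈W₀ (F f₀)) (f₀ , f₀∈W₁ , ≈M-refl))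
  ... | suc _ , _ , F[W₁]≈W with proj₂ (F[W₁]≈W f₀) (W-mono (s≤s z≤n) f₀∈W₁)
  ... | y , y∈W₁ , Fy≈f₀ with W₁⇒multiple y∈W₁
  ... | b , y≈bf₀ = contradiction (x≈a·Fx⇒x≈0 nilpotent f₀≈σb·Ff₀) f₀≉0
    where
    f₀≈σb·Ff₀ : f₀ ≈M (σ b ·M F f₀)
    f₀≈σb·Ff₀ = ≈M-trans (≈M-sym Fy≈f₀) (≈M-trans (F-cong y≈bf₀) (F-semilinear b f₀))

  WKer₀-dim-0 : HasDim (WKer f 0) 0
  WKer₀-dim-0 =
    (λ ()) , (λ _ _ ()) , (λ ()) , (λ x x∈ → (λ ()) , W₀≈0 (proj₁ x∈)) ,
    λ x (_ , x≈0) → ≈0⇒W x≈0 , lift (F-zero x≈0)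

  WKer₁-dim-1 : F f₀ ≈M 0M → HasDim (WKer f 1) 1
  WKer₁-dim-1 Ff₀≈0 = (λ _ → f₀) , independent₁ , (λ _ → f₀∈W₁ , lift Ff₀≈0) , spanned , spans
    where
    one-term : ∀ (a : Fin 1 → Carrier) → sumM 1 (λ l → a l ·M f₀) ≈M (a fzero ·M f₀)
    one-term a i j = +-identityʳ _
    independent₁ : LinIndep 1 (λ _ → f₀)
    independent₁ a af₀≈0 fzero =
      LinIndep-head {g = f} independent (a fzero) (≈M-trans (≈M-sym (one-term a)) af₀≈0)
    spanned : ∀ x → WKer f 1 x → Span 1 (λ _ → f₀) x
    spanned x (x∈W₁ , _) =
      let b , x≈bf₀ = W₁⇒multiple x∈W₁ in (λ _ → b) , ≈M-trans x≈bf₀ (≈M-sym (one-term (λ _ → b)))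
    spans : ∀ x → Span 1 (λ _ → f₀) x → WKer f 1 x
    spans x (a , x≈) = multiple⇒W₁ x≈af₀ , lift Fx≈0
      where
      x≈af₀ = ≈M-trans x≈ (one-term a)
      Fx≈0 : F x ≈M 0M
      Fx≈0 i j = trans (F-cong x≈af₀ i j)
        (trans (F-semilinear (a fzero) f₀ i j) (trans (*-congˡ (Ff₀≈0 i j)) (zeroʳ _)))

  F-kills-f₀⇒EtaIncr-1 : F f₀ ≈M 0M → EtaIncr f 1
  F-kills-f₀⇒EtaIncr-1 Ff₀≈0 = 0 , WKer₀-dim-0 , WKer₁-dim-1 Ff₀≈0

  EtaIncr-1⇒Omega-1-1 : EtaIncr f 1 → Omega f 1 1
  EtaIncr-1⇒Omega-1-1 η = inj₁ (η , c-yes η c-zero)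

  Omega-1-1⇒EtaIncr-1 : Omega f 1 1 → EtaIncr f 1
  Omega-1-1⇒EtaIncr-1 (inj₁ (η , _)) = η
  Omega-1-1⇒EtaIncr-1 (inj₂ (¬η , m , count , 1≡q+m)) =
    contradiction (≡.subst (Count _ 1) m≡0 count) λ { (c-no ¬¬η c-zero) → ¬¬η ¬η }
    where
    m≡0 : m ≡ 0
    m≡0 = ℕₚ.m+n≡0⇒n≡0 r (≡.sym (ℕₚ.suc-injective 1≡q+m))

  EtaIncr-1⇒kernel-vector : EtaIncr f 1 → Σ M λ g → W f 1 g × F g ≈M 0M × ¬ g ≈M 0M
  EtaIncr-1⇒kernel-vector (_ , _ , g , independent-g , g∈ , _) =
    g fzero , proj₁ (g∈ fzero) , lower (proj₂ (g∈ fzero)) , LinIndep-head≉0 {g = g} independent-g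

  ImF-cong : ∀ {S T} → SameSub S T → SameSub (ImF S) (ImF T)
  ImF-cong S≈T x = (λ { (y , y∈S , Fy≈x) → y , proj₁ (S≈T y) y∈S , Fy≈x })
                 , (λ { (y , y∈T , Fy≈x) → y , proj₂ (S≈T y) y∈T , Fy≈x })

  SameSub-trans : ∀ {S T U} → SameSub S T → SameSub T U → SameSub S U
  SameSub-trans S≈T T≈U x = proj₁ (T≈U x) ∘ proj₁ (S≈T x) , proj₂ (S≈T x) ∘ proj₂ (T≈U x)

  F-image-in-flag : ∀ n → InFlag f (F-image n)
  F-image-in-flag zero = 2 ℕ.* suc r , ℕₚ.≤-refl , λ x → (λ _ → W-top x) , _
  F-image-in-flag (suc n) =
    let a , a≤2q , Fⁿ≈Wₐ = F-image-in-flag n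
        b , b≤2q , F[Wₐ]≈W_b = proj₁ (proj₂ final a a≤2q)
    in b , b≤2q , SameSub-trans (ImF-cong Fⁿ≈Wₐ) F[Wₐ]≈W_b

  periodic⇒¬EtaIncr-1 : ∀ {E} → ¬ E ≈M 0M → F (F E) ≈M E →
    ∀ N → (∀ {g} y → g ≈M iter N F y → F g ≈M 0M → g ≈M 0M) → ¬ EtaIncr f 1
  periodic⇒¬EtaIncr-1 {E} E≉0 FFE≈E N ker∩im≈0 η with EtaIncr-1⇒kernel-vector η | F-image-in-flag N
  ... | _ , _ , _ , _ | zero , _ , Fᴺ≈W₀ =
    E≉0 (W₀≈0 (proj₁ (Fᴺ≈W₀ E) (proj₁ (periodic∈F-image FFE≈E N))))
  ... | g , g∈W₁ , Fg≈0 , g≉0 | suc _ , _ , Fᴺ≈W =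
    let y , g≈Fᴺy = F-image⇒iterate N (proj₂ (Fᴺ≈W g) (W-mono (s≤s z≤n) g∈W₁)) in
    g≉0 (ker∩im≈0 y g≈Fᴺy Fg≈0)

lemma5p5 : ∀ {c ℓ} (K : AlgClosureFp c ℓ) (q u v : ℕ) →
    2 ≤ q → 1 ≤ u → u < v → v ≤ q →
    (f : Fin (2 Data.Nat.* q) → Module.M K q u v) →
    Module.IsFinal K q u v f →
    (Module.FNilpotent K q u v → Module.Omega K q u v f 1 1) ×
    (Module.Omega K q u v f 1 1 → Module.FNilpotent K q u v)
lemma5p5 K (suc r) u v _ _ u<v v≤q f final = nilpotent⇒ω₁≡1 , ω₁≡1⇒nilpotent
  where
  open Module K (suc r) u v
  open FrobeniusOnM K (suc r) u v
  open FinalFlag K r u v f final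

  nilpotent⇒ω₁≡1 : FNilpotent → Omega f 1 1
  nilpotent⇒ω₁≡1 = EtaIncr-1⇒Omega-1-1 ∘ F-kills-f₀⇒EtaIncr-1 ∘ nilpotent⇒F-kills-f₀

  ω₁≡1⇒nilpotent : Omega f 1 1 → FNilpotent
  ω₁≡1⇒nilpotent ω with HasCycle? (suc r) u v
  ... | no acyclic = acyclic⇒nilpotent u<v v≤q acyclic
  ... | yes cycle  = contradiction (Omega-1-1⇒EtaIncr-1 ω)
    (periodic⇒¬EtaIncr-1 (basis≉0 fzero fzero) (basis-on-cycle-periodic u<v v≤q (cycle , inj₁ ≡.refl))
                         6 (ker-F∩im-F⁶≈0 u<v v≤q))
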